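{- Let $q=p^t$ where $p$ is a prime and $t\ge0$ is an integer, and let $n=r\cdot q$ with $r$ a positive integer. Then for every $S\subseteq[n-1]$, $$\beta_n(S)\equiv(-1)^{|S-q\cdot[r-1]|}\cdot\beta_r(S/q)\bmod p.$$
   Context: For $S\subseteq[m-1]$, $\beta_m(S)$ is the number of permutations $\pi\in\mathfrak{S}_m$ with descent set $\{i:\pi_i>\pi_{i+1}\}$ equal to $S$ (with $\beta_1(\varnothing)=1$). For a set $S$ of integers and a nonzero integer $q$: $q\cdot S=\{qs: s\in S\}$ and $S/q=\{s/q: s\in S,\ q\mid s\}$. Here $[r-1]=\{1,\dots,r-1\}$ and $S-q\cdot[r-1]$ denotes set difference. -}

module Defs where

open import Data.Bool using (Bool; true; false; _∧_; not; _xor_)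
open import Data.Nat using (ℕ; zero; suc; _∸_; _*_; _<ᵇ_; _≡ᵇ_)
open import Data.List using (List; []; _∷_; map; concatMap; upTo; length; filterᵇ)
open import Data.Bool.ListAction using (all; any)

interval : ℕ → List ℕ
interval k = map suc (upTo (k ∸ 1))

Setℕ : Set
Setℕ = ℕ → Bool

insertAll : ℕ → List ℕ → List (List ℕ)
insertAll x []       = (x ∷ []) ∷ []
insertAll x (y ∷ ys) = (x ∷ y ∷ ys) ∷ map (y ∷_) (insertAll x ys)

perms : ℕ → List (List ℕ)
perms zero    = [] ∷ []
perms (suc m) = concatMap (insertAll (suc m)) (perms m)

-- isDesc π i = true iff π_i > π_{i+1} (positions 1-indexed).
isDesc : List ℕ → ℕ → Bool
isDesc (a ∷ b ∷ rest) (suc zero)    = b <ᵇ a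
isDesc (_ ∷ rest)     (suc (suc i)) = isDesc rest (suc i)
isDesc _              _             = false

hasDescSet : ℕ → Setℕ → List ℕ → Bool
hasDescSet m S π = all (λ i → not (isDesc π i xor S i)) (interval m)

β : ℕ → Setℕ → ℕ
β m S = length (filterᵇ (hasDescSet m S) (perms m))

scaledInterval : ℕ → ℕ → Setℕ
scaledInterval q r i = any (λ j → (q * j) ≡ᵇ i) (interval r)

-- S / q = {s/q : s ∈ S, q ∣ s} = {j : q j ∈ S}  (for q > 0)
divSet : Setℕ → ℕ → Setℕ
divSet S q j = S (q * j)

cardDiff : ℕ → Setℕ → ℕ → ℕ → ℕ
cardDiff n S q r = length (filterᵇ (λ i → S i ∧ not (scaledInterval q r i)) (interval n))

-- A pattern w prescribes, at each position i, an ascent, a descent or nothing ("free") between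
-- π_i and π_(i+1); β_m(S) counts the permutations fitting the pattern with descents exactly on S.
-- Since "free" = "descent" + "ascent", each descent can be traded for the difference of a free
-- and an ascending position, leaving descent-free patterns.  A descent-free pattern whose last
-- free position below n is t is fitted by C(n,t) times as many permutations as its restriction
-- to length t (the entries after position t increase).  Modulo p, with n = r q and q = p^t, C(n,i)
-- vanishes unless q | i and C(rq, sq) ≡ C(r, s) (Lucas), so the count for n reduces to the
-- count for r of the pattern read at multiples of q, and vanishes if some free position is not
-- a multiple of q.  Only the descents off q·[r-1] then survive, each contributing a sign.

module Submission where

open import Defs
open import Data.Bool using (true)
open import Data.Nat using (ℕ; _≤_; _<_; _*_; _^_)
open import Data.Nat.Primality using (Prime)
open import Data.Integer using (ℤ; +_; -[1+_]; _-_) renaming (_*_ to _*ℤ_; _^_ to _^ℤ_)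
open import Data.Integer.Divisibility using (_∣_)
open import Data.Product using (_×_)
open import Relation.Binary.PropositionalEquality using (_≡_)

open import Algebra.Bundles using (CommutativeMonoid)
open import Data.Bool using (Bool; false; not; _∧_; _xor_; if_then_else_)
open import Data.Bool.ListAction using (all; and)
open import Data.Bool.Properties using (∧-identityʳ; ∧-zeroʳ; ∧-assoc; ∧-commutativeMonoid; T-≡; ¬-not)
open import Data.Integer using (0ℤ; -1ℤ; -_) renaming (_+_ to _+ℤ_)
import Data.Integer.Divisibility.Signed as ℤ∣
import Data.Integer.Properties as ℤₚ
open import Data.Integer.Tactic.RingSolver using (solve-∀)
open import Data.List using (List; []; _∷_; _++_; map; length; concatMap; upTo; applyUpTo; filterᵇ)
open import Data.List.Properties using (map-∘; map-upTo; map-++; upTo-∷ʳ)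
open import Data.List.Relation.Unary.All as All using (All; []; _∷_)
import Data.List.Relation.Unary.All.Properties as Allₚ
open import Data.List.Relation.Unary.Any using (satisfied)
import Data.List.Relation.Unary.Any.Properties as Anyₚ
open import Data.Nat using (NonZero; >-nonZero; zero; suc; _+_; _∸_; _<ᵇ_; _≡ᵇ_; s≤s; z≤n; _≟_; _<?_; _≤?_)
open import Data.Nat.Combinatorics using (_C_; nCk+nC[k+1]≡[n+1]C[k+1]; nCn≡1; nC1≡n; k>n⇒nCk≡0)
import Data.Nat.Divisibility as ℕ∣
open import Data.Nat.Induction using (<-wellFounded)
open import Data.Nat.ListAction using (sum)
open import Data.Nat.ListAction.Properties using (sum-++)
open import Data.Nat.Primality using (euclidsLemma; ¬prime[0])
open import Data.Nat.Properties
open import Data.Product using (_,_; proj₁; proj₂; ∃-syntax)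
open import Data.Sum using (_⊎_; inj₁; inj₂; [_,_])
open import Function using (_∘_)
open import Function.Bundles using (Equivalence)
open import Induction.WellFounded using (Acc; acc)
open import Level using (0ℓ)
open import Relation.Binary using (IsEquivalence; Setoid)
open import Relation.Binary.PropositionalEquality using (_≢_; refl; sym; trans; cong; cong₂; subst; subst₂; module ≡-Reasoning)
import Relation.Binary.Reasoning.Setoid as SetoidReasoning
open import Relation.Nullary using (¬_; contradiction; yes; no)

open import Algebra.Properties.CommutativeSemigroup (CommutativeMonoid.commutativeSemigroup ∧-commutativeMonoid)
  using () renaming (x∙yz≈y∙xz to ∧-x∙yz≈y∙xz)
open import Algebra.Properties.CommutativeSemigroup *-commutativeSemigroup using () renaming (x∙yz≈y∙xz to *-x∙yz≈y∙xz)
open import Algebra.Properties.CommutativeSemigroup +-commutativeSemigroup using () renaming (interchange to +-interchange)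

-- Congruences modulo an integer

module Congruence (m : ℤ) where

  infix 4 _≈_
  record _≈_ (a b : ℤ) : Set where
    constructor mod
    field divides : m ℤ∣.∣ a - b

  ≈-reflexive : ∀ {a b} → a ≡ b → a ≈ b
  ≈-reflexive {a} refl = mod (ℤ∣.divides 0ℤ (trans (ℤₚ.+-inverseʳ a) (sym (ℤₚ.*-zeroˡ m))))

  ≈-refl : ∀ {a} → a ≈ a
  ≈-refl = ≈-reflexive refl

  ≈-sym : ∀ {a b} → a ≈ b → b ≈ a
  ≈-sym {a} {b} (mod a≈b) = mod (subst (m ℤ∣.∣_) (minus-swap a b) (ℤ∣.∣m⇒∣-m a≈b))
    where
    minus-swap : ∀ a b → - (a - b) ≡ b - a
    minus-swap = solve-∀

  ≈-trans : ∀ {a b c} → a ≈ b → b ≈ c → a ≈ c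
  ≈-trans {a} {b} {c} (mod a≈b) (mod b≈c) =
    mod (subst (m ℤ∣.∣_) (ℤₚ.+-minus-telescope a b c) (ℤ∣.∣m∣n⇒∣m+n a≈b b≈c))

  ≈-isEquivalence : IsEquivalence _≈_
  ≈-isEquivalence = record { refl = ≈-refl ; sym = ≈-sym ; trans = ≈-trans }

  ≈-setoid : Setoid 0ℓ 0ℓ
  ≈-setoid = record { isEquivalence = ≈-isEquivalence }

  +-cong : ∀ {a b c d} → a ≈ b → c ≈ d → a +ℤ c ≈ b +ℤ d
  +-cong {a} {b} {c} {d} (mod a≈b) (mod c≈d) =
    mod (subst (m ℤ∣.∣_) (regroup a b c d) (ℤ∣.∣m∣n⇒∣m+n a≈b c≈d))
    where
    regroup : ∀ a b c d → (a - b) +ℤ (c - d) ≡ (a +ℤ c) - (b +ℤ d)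
    regroup = solve-∀

  *-cong : ∀ {a b c d} → a ≈ b → c ≈ d → a *ℤ c ≈ b *ℤ d
  *-cong {a} {b} {c} {d} (mod a≈b) (mod c≈d) =
    mod (subst (m ℤ∣.∣_) (regroup a b c d) (ℤ∣.∣m∣n⇒∣m+n (ℤ∣.∣m⇒∣m*n c a≈b) (ℤ∣.∣n⇒∣m*n b c≈d)))
    where
    regroup : ∀ a b c d → (a - b) *ℤ c +ℤ b *ℤ (c - d) ≡ a *ℤ c - b *ℤ d
    regroup = solve-∀

  -‿cong : ∀ {a b} → a ≈ b → - a ≈ - b
  -‿cong {a} {b} (mod a≈b) = mod (subst (m ℤ∣.∣_) (regroup a b) (ℤ∣.∣m⇒∣-m a≈b))
    where
    regroup : ∀ a b → - (a - b) ≡ - a - - b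
    regroup = solve-∀

  +-cancelʳ : ∀ {a b c d} → a +ℤ c ≈ b +ℤ d → c ≈ d → a ≈ b
  +-cancelʳ {a} {b} {c} {d} a+c≈b+d c≈d = subst₂ _≈_ (cancel a c) (cancel b d) (+-cong a+c≈b+d (-‿cong c≈d))
    where
    cancel : ∀ x y → (x +ℤ y) +ℤ - y ≡ x
    cancel = solve-∀

  ∣⇒≈0 : ∀ {a} → m ∣ a → a ≈ 0ℤ
  ∣⇒≈0 {a} m∣a = mod (subst (m ℤ∣.∣_) (sym (ℤₚ.+-identityʳ a)) (ℤ∣.∣ᵤ⇒∣ m∣a))

  pos-+-cong : ∀ {a b c d} → + a ≈ + b → + c ≈ + d → + (a + c) ≈ + (b + d)
  pos-+-cong {a} {b} {c} {d} a≈b c≈d =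
    subst₂ _≈_ (sym (ℤₚ.pos-+ a c)) (sym (ℤₚ.pos-+ b d)) (+-cong a≈b c≈d)

  pos-*-cong : ∀ {a b c d} → + a ≈ + b → + c ≈ + d → + (a * c) ≈ + (b * d)
  pos-*-cong {a} {b} {c} {d} a≈b c≈d =
    subst₂ _≈_ (sym (ℤₚ.pos-* a c)) (sym (ℤₚ.pos-* b d)) (*-cong a≈b c≈d)

-- Binomial coefficients modulo a prime

[k+1]*[n+1]C[k+1]≡[n+1]*nCk : ∀ n k → suc k * (suc n C suc k) ≡ suc n * (n C k)
[k+1]*[n+1]C[k+1]≡[n+1]*nCk n zero = trans (+-identityʳ _) (trans (nC1≡n (suc n)) (sym (*-identityʳ (suc n))))
[k+1]*[n+1]C[k+1]≡[n+1]*nCk zero (suc k) = *-zeroʳ (suc (suc k))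
[k+1]*[n+1]C[k+1]≡[n+1]*nCk (suc n) (suc k) = begin
    suc (suc k) * (suc (suc n) C suc (suc k))
  ≡⟨ cong (suc (suc k) *_) (sym (nCk+nC[k+1]≡[n+1]C[k+1] (suc n) (suc k))) ⟩
    suc (suc k) * (suc n C suc k + suc n C suc (suc k))
  ≡⟨ *-distribˡ-+ (suc (suc k)) (suc n C suc k) _ ⟩
    suc n C suc k + suc k * (suc n C suc k) + suc (suc k) * (suc n C suc (suc k))
  ≡⟨ cong₂ (λ a b → suc n C suc k + a + b) ([k+1]*[n+1]C[k+1]≡[n+1]*nCk n k) ([k+1]*[n+1]C[k+1]≡[n+1]*nCk n (suc k)) ⟩
    suc n C suc k + suc n * (n C k) + suc n * (n C suc k)
  ≡⟨ +-assoc (suc n C suc k) _ _ ⟩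
    suc n C suc k + (suc n * (n C k) + suc n * (n C suc k))
  ≡⟨ cong (_+_ (suc n C suc k)) (sym (*-distribˡ-+ (suc n) (n C k) _)) ⟩
    suc n C suc k + suc n * (n C k + n C suc k)
  ≡⟨ cong (λ c → suc n C suc k + suc n * c) (nCk+nC[k+1]≡[n+1]C[k+1] n k) ⟩
    suc (suc n) * (suc n C suc k)
  ∎
  where open ≡-Reasoning

p∣pCk : ∀ {p k} → Prime p → 0 < k → k < p → p ℕ∣.∣ p C k
p∣pCk {suc p-1} {suc k-1} p-prime _ k<p
  with euclidsLemma (suc k-1) _ p-prime
         (subst (suc p-1 ℕ∣.∣_) (sym ([k+1]*[n+1]C[k+1]≡[n+1]*nCk p-1 k-1)) (ℕ∣.m∣m*n (p-1 C k-1)))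
... | inj₁ p∣k = contradiction (ℕ∣.∣⇒≤ p∣k) (<⇒≱ k<p)
... | inj₂ p∣C = p∣C

module BinomialsModPrime (p-1 : ℕ) (p-prime : Prime (suc p-1)) where

  p : ℕ
  p = suc p-1

  open Congruence (+ p)
  open SetoidReasoning ≈-setoid

  pos-pascal : ∀ n k → + (n C k + n C suc k) ≈ + (suc n C suc k)
  pos-pascal n k = ≈-reflexive (cong +_ (nCk+nC[k+1]≡[n+1]C[k+1] n k))

  -- Vandermonde's identity for (m + p) choose k, where p choose j ≡ 0 unless j ∈ {0, p}.
  [m+p]Ck≈mCk : ∀ m {k} → k < p → + ((m + p) C k) ≈ + (m C k)
  [m+p]C[k+p]≈mC[k+p]+mCk : ∀ m k → + ((m + p) C (k + p)) ≈ + (m C (k + p) + m C k)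

  [m+p]Ck≈mCk m       {zero}  _   = ≈-refl
  [m+p]Ck≈mCk zero    {suc k} k<p = ∣⇒≈0 (p∣pCk p-prime (s≤s z≤n) k<p)
  [m+p]Ck≈mCk (suc m) {suc k} k<p = begin
    + (suc (m + p) C suc k)              ≈⟨ ≈-sym (pos-pascal (m + p) k) ⟩
    + ((m + p) C k + (m + p) C suc k)    ≈⟨ pos-+-cong ([m+p]Ck≈mCk m (<⇒≤ k<p)) ([m+p]Ck≈mCk m k<p) ⟩
    + (m C k + m C suc k)                ≈⟨ pos-pascal m k ⟩
    + (suc m C suc k)                    ∎

  [m+p]C[k+p]≈mC[k+p]+mCk zero    zero    = ≈-reflexive (cong +_ (nCn≡1 p))
  [m+p]C[k+p]≈mC[k+p]+mCk zero    (suc k) = ≈-reflexive (cong +_ (k>n⇒nCk≡0 (s≤s (m≤n+m p k))))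
  [m+p]C[k+p]≈mC[k+p]+mCk (suc m) zero    = begin
    + (suc (m + p) C p)                          ≈⟨ ≈-sym (pos-pascal (m + p) p-1) ⟩
    + ((m + p) C p-1 + (m + p) C p)              ≈⟨ pos-+-cong ([m+p]Ck≈mCk m ≤-refl) ([m+p]C[k+p]≈mC[k+p]+mCk m zero) ⟩
    + (m C p-1 + (m C p + 1))                    ≡⟨ cong +_ (sym (+-assoc (m C p-1) (m C p) 1)) ⟩
    + ((m C p-1 + m C p) + 1)                    ≈⟨ pos-+-cong (pos-pascal m p-1) ≈-refl ⟩
    + (suc m C p + 1)                            ∎
  [m+p]C[k+p]≈mC[k+p]+mCk (suc m) (suc k) = begin
    + (suc (m + p) C suc (k + p))
      ≈⟨ ≈-sym (pos-pascal (m + p) (k + p)) ⟩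
    + ((m + p) C (k + p) + (m + p) C (suc k + p))
      ≈⟨ pos-+-cong ([m+p]C[k+p]≈mC[k+p]+mCk m k) ([m+p]C[k+p]≈mC[k+p]+mCk m (suc k)) ⟩
    + ((m C (k + p) + m C k) + (m C (suc k + p) + m C suc k))
      ≡⟨ cong +_ (+-interchange (m C (k + p)) (m C k) _ _) ⟩
    + ((m C (k + p) + m C (suc k + p)) + (m C k + m C suc k))
      ≈⟨ pos-+-cong (pos-pascal m (k + p)) (pos-pascal m k) ⟩
    + (suc m C (suc k + p) + suc m C suc k)
      ∎

  [ap]C[bp]≈aCb : ∀ a b → + ((a * p) C (b * p)) ≈ + (a C b)
  [ap]C[bp]≈aCb zero    zero    = ≈-refl
  [ap]C[bp]≈aCb zero    (suc b) = ≈-refl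
  [ap]C[bp]≈aCb (suc a) zero    = ≈-refl
  [ap]C[bp]≈aCb (suc a) (suc b) = begin
    + ((p + a * p) C (p + b * p))                  ≡⟨ cong₂ (λ m k → + (m C k)) (+-comm p (a * p)) (+-comm p (b * p)) ⟩
    + ((a * p + p) C (b * p + p))                  ≈⟨ [m+p]C[k+p]≈mC[k+p]+mCk (a * p) (b * p) ⟩
    + ((a * p) C (b * p + p) + (a * p) C (b * p))  ≡⟨ cong (λ k → + ((a * p) C k + (a * p) C (b * p))) (+-comm (b * p) p) ⟩
    + ((a * p) C (suc b * p) + (a * p) C (b * p))  ≈⟨ pos-+-cong ([ap]C[bp]≈aCb a (suc b)) ([ap]C[bp]≈aCb a b) ⟩
    + (a C suc b + a C b)                          ≡⟨ cong +_ (+-comm (a C suc b) (a C b)) ⟩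
    + (a C b + a C suc b)                          ≈⟨ pos-pascal a b ⟩
    + (suc a C suc b)                              ∎

  [ap]Ci≈0 : ∀ a {i} → ¬ p ℕ∣.∣ i → + ((a * p) C i) ≈ 0ℤ
  [ap]Ci≈0 zero    {zero}  p∤0 = contradiction (ℕ∣.divides 0 refl) p∤0
  [ap]Ci≈0 zero    {suc i} _   = ≈-refl
  [ap]Ci≈0 (suc a) {i}     p∤i with i <? p
  ... | yes i<p = begin
    + ((p + a * p) C i)   ≡⟨ cong (λ m → + (m C i)) (+-comm p (a * p)) ⟩
    + ((a * p + p) C i)   ≈⟨ [m+p]Ck≈mCk (a * p) i<p ⟩
    + ((a * p) C i)       ≈⟨ [ap]Ci≈0 a p∤i ⟩
    0ℤ                    ∎
  ... | no i≮p = begin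
    + ((p + a * p) C i)                        ≡⟨ cong₂ (λ m k → + (m C k)) (+-comm p (a * p)) (sym i∸p+p≡i) ⟩
    + ((a * p + p) C (i ∸ p + p))              ≈⟨ [m+p]C[k+p]≈mC[k+p]+mCk (a * p) (i ∸ p) ⟩
    + ((a * p) C (i ∸ p + p) + (a * p) C (i ∸ p)) ≈⟨ pos-+-cong ([ap]Ci≈0 a p∤i∸p+p) ([ap]Ci≈0 a p∤i∸p) ⟩
    0ℤ                                         ∎
    where
    i∸p+p≡i : i ∸ p + p ≡ i
    i∸p+p≡i = m∸n+n≡m (≮⇒≥ i≮p)
    p∤i∸p+p : ¬ p ℕ∣.∣ i ∸ p + p
    p∤i∸p+p = subst (λ k → ¬ p ℕ∣.∣ k) (sym i∸p+p≡i) p∤i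
    p∤i∸p : ¬ p ℕ∣.∣ i ∸ p
    p∤i∸p p∣i∸p = p∤i∸p+p (ℕ∣.∣m∣n⇒∣m+n p∣i∸p ℕ∣.∣-refl)

  [rq]C[sq]≈rCs : ∀ t r s → + ((r * p ^ t) C (s * p ^ t)) ≈ + (r C s)
  [rq]C[sq]≈rCs zero    r s = ≈-reflexive (cong₂ (λ m k → + (m C k)) (*-identityʳ r) (*-identityʳ s))
  [rq]C[sq]≈rCs (suc t) r s = begin
    + ((r * (p * p ^ t)) C (s * (p * p ^ t)))   ≡⟨ cong₂ (λ m k → + (m C k)) (sym (*-assoc r p (p ^ t))) (sym (*-assoc s p (p ^ t))) ⟩
    + ((r * p * p ^ t) C (s * p * p ^ t))       ≈⟨ [rq]C[sq]≈rCs t (r * p) (s * p) ⟩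
    + ((r * p) C (s * p))                       ≈⟨ [ap]C[bp]≈aCb r s ⟩
    + (r C s)                                   ∎

  [rq]Ci≈0 : ∀ t r {i} → ¬ p ^ t ℕ∣.∣ i → + ((r * p ^ t) C i) ≈ 0ℤ
  [rq]Ci≈0 zero    r {i} 1∤i = contradiction (ℕ∣.1∣ i) 1∤i
  [rq]Ci≈0 (suc t) r {i} q∤i with p ^ t ℕ∣.∣? i
  ... | no p^t∤i = begin
    + ((r * (p * p ^ t)) C i)   ≡⟨ cong (λ m → + (m C i)) (sym (*-assoc r p (p ^ t))) ⟩
    + ((r * p * p ^ t) C i)     ≈⟨ [rq]Ci≈0 t (r * p) p^t∤i ⟩
    0ℤ                          ∎
  ... | yes (ℕ∣.divides j refl) = begin
    + ((r * (p * p ^ t)) C (j * p ^ t))   ≡⟨ cong (λ m → + (m C (j * p ^ t))) (sym (*-assoc r p (p ^ t))) ⟩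
    + ((r * p * p ^ t) C (j * p ^ t))     ≈⟨ [rq]C[sq]≈rCs t (r * p) j ⟩
    + ((r * p) C j)                       ≈⟨ [ap]Ci≈0 r {j} (λ p∣j → q∤i (ℕ∣.*-monoˡ-∣ (p ^ t) p∣j)) ⟩
    0ℤ                                    ∎

-- Sums and counts

𝟙 : Bool → ℕ
𝟙 true  = 1
𝟙 false = 0

𝟙-∧ : ∀ a b → 𝟙 (a ∧ b) ≡ 𝟙 a * 𝟙 b
𝟙-∧ false b = refl
𝟙-∧ true  b = sym (+-identityʳ (𝟙 b))

count : {A : Set} → (A → Bool) → List A → ℕ
count f xs = sum (map (𝟙 ∘ f) xs)

length-filterᵇ : {A : Set} (f : A → Bool) (xs : List A) → length (filterᵇ f xs) ≡ count f xs
length-filterᵇ f []       = refl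
length-filterᵇ f (x ∷ xs) with f x
... | true  = cong suc (length-filterᵇ f xs)
... | false = length-filterᵇ f xs

sum-map-cong : {A : Set} {f g : A → ℕ} {xs : List A} → All (λ x → f x ≡ g x) xs → sum (map f xs) ≡ sum (map g xs)
sum-map-cong []         = refl
sum-map-cong (eq ∷ eqs) = cong₂ _+_ eq (sum-map-cong eqs)

count-cong : {A : Set} {f g : A → Bool} {xs : List A} → All (λ x → f x ≡ g x) xs → count f xs ≡ count g xs
count-cong eqs = sum-map-cong (All.map (cong 𝟙) eqs)

sum-map-+ : {A : Set} (f g : A → ℕ) (xs : List A) → sum (map (λ x → f x + g x) xs) ≡ sum (map f xs) + sum (map g xs)
sum-map-+ f g []       = refl
sum-map-+ f g (x ∷ xs) = trans (cong (_+_ (f x + g x)) (sum-map-+ f g xs)) (+-interchange (f x) (g x) _ _)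

sum-map-*ˡ : {A : Set} (xs : List A) (c : ℕ) (f : A → ℕ) → sum (map (λ x → c * f x) xs) ≡ c * sum (map f xs)
sum-map-*ˡ []       c f = sym (*-zeroʳ c)
sum-map-*ˡ (x ∷ xs) c f = trans (cong (_+_ (c * f x)) (sum-map-*ˡ xs c f)) (sym (*-distribˡ-+ c (f x) _))

sum-map-concatMap : {A B : Set} (f : B → ℕ) (g : A → List B) (xs : List A) →
  sum (map f (concatMap g xs)) ≡ sum (map (λ x → sum (map f (g x))) xs)
sum-map-concatMap f g []       = refl
sum-map-concatMap f g (x ∷ xs) = begin
  sum (map f (g x ++ concatMap g xs))                     ≡⟨ cong sum (map-++ f (g x) (concatMap g xs)) ⟩
  sum (map f (g x) ++ map f (concatMap g xs))             ≡⟨ sum-++ (map f (g x)) _ ⟩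
  sum (map f (g x)) + sum (map f (concatMap g xs))        ≡⟨ cong (_+_ (sum (map f (g x)))) (sum-map-concatMap f g xs) ⟩
  sum (map f (g x)) + sum (map (λ x → sum (map f (g x))) xs) ∎
  where open ≡-Reasoning

count-map : {A B : Set} (f : B → Bool) (g : A → B) (xs : List A) → count f (map g xs) ≡ count (f ∘ g) xs
count-map f g xs = cong sum (sym (map-∘ xs))

count-false : {A : Set} (xs : List A) → count (λ _ → false) xs ≡ 0
count-false []       = refl
count-false (_ ∷ xs) = count-false xs

all-map : {A B : Set} (f : B → Bool) (g : A → B) (xs : List A) → all f (map g xs) ≡ all (f ∘ g) xs
all-map f g xs = cong and (sym (map-∘ xs))

<⇒<ᵇ≡true : ∀ {m n} → m < n → (m <ᵇ n) ≡ true
<⇒<ᵇ≡true m<n = Equivalence.to T-≡ (<⇒<ᵇ m<n)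

≥⇒<ᵇ≡false : ∀ {m n} → n ≤ m → (m <ᵇ n) ≡ false
≥⇒<ᵇ≡false {m} {n} n≤m = ¬-not (λ m<ᵇn → <⇒≱ (<ᵇ⇒< m n (Equivalence.from T-≡ m<ᵇn)) n≤m)

≡ᵇ-refl : ∀ n → (n ≡ᵇ n) ≡ true
≡ᵇ-refl n = Equivalence.to T-≡ (≡⇒≡ᵇ n n refl)

≢⇒≡ᵇ≡false : ∀ {m n} → m ≢ n → (m ≡ᵇ n) ≡ false
≢⇒≡ᵇ≡false {m} {n} m≢n = ¬-not (λ m≡ᵇn → m≢n (≡ᵇ⇒≡ m n (Equivalence.from T-≡ m≡ᵇn)))

count-update : ∀ {f g : ℕ → Bool} j xs → (∀ i → i ≢ j → f i ≡ g i) → f j ≡ true → g j ≡ false →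
  count f xs ≡ count g xs + count (_≡ᵇ j) xs
count-update j []       _     _      _      = refl
count-update {g = g} j (i ∷ xs) f≗g f[j] g[j] with i ≟ j
... | yes refl rewrite f[j] | g[j] | ≡ᵇ-refl i =
  trans (cong suc (count-update j xs f≗g f[j] g[j])) (sym (+-suc _ _))
... | no  i≢j  rewrite f≗g i i≢j | ≢⇒≡ᵇ≡false i≢j =
  trans (cong (_+_ (𝟙 (g i))) (count-update j xs f≗g f[j] g[j])) (sym (+-assoc (𝟙 (g i)) _ _))

count-≡ᵇ-upTo : ∀ {j k} → j < k → count (_≡ᵇ j) (upTo k) ≡ 1
count-≡ᵇ-upTo {j} {suc k} j<k = begin
  count (_≡ᵇ j) (0 ∷ applyUpTo suc k)          ≡⟨ cong (λ xs → count (_≡ᵇ j) (0 ∷ xs)) (sym (map-upTo suc k)) ⟩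
  count (_≡ᵇ j) (0 ∷ map suc (upTo k))         ≡⟨ cong (_+_ (𝟙 (0 ≡ᵇ j))) (count-map (_≡ᵇ j) suc (upTo k)) ⟩
  𝟙 (0 ≡ᵇ j) + count ((_≡ᵇ j) ∘ suc) (upTo k)  ≡⟨ occurrences j j<k ⟩
  1                                            ∎
  where
  open ≡-Reasoning
  occurrences : ∀ j → j < suc k → 𝟙 (0 ≡ᵇ j) + count ((_≡ᵇ j) ∘ suc) (upTo k) ≡ 1
  occurrences zero     _           = cong suc (count-false (upTo k))
  occurrences (suc j′) (s≤s j′<k) = count-≡ᵇ-upTo j′<k

count-≡ᵇ-interval : ∀ {j n} → 0 < j → j < n → count (_≡ᵇ j) (interval n) ≡ 1
count-≡ᵇ-interval {suc j} {suc n} _ (s≤s j<n) = trans (count-map (_≡ᵇ suc j) suc (upTo n)) (count-≡ᵇ-upTo j<n)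

sumBelow : ℕ → (ℕ → ℕ) → ℕ
sumBelow zero    f = 0
sumBelow (suc n) f = sumBelow n f + f n

sumBelow-cong : ∀ n {f g} → (∀ k → k < n → f k ≡ g k) → sumBelow n f ≡ sumBelow n g
sumBelow-cong zero    eq = refl
sumBelow-cong (suc n) eq = cong₂ _+_ (sumBelow-cong n (λ k k<n → eq k (m≤n⇒m≤1+n k<n))) (eq n ≤-refl)

sumBelow-*ˡ : ∀ n c f → sumBelow n (λ k → c * f k) ≡ c * sumBelow n f
sumBelow-*ˡ zero    c f = sym (*-zeroʳ c)
sumBelow-*ˡ (suc n) c f = trans (cong (_+ c * f n) (sumBelow-*ˡ n c f)) (sym (*-distribˡ-+ c _ (f n)))

sumBelow-0 : ∀ n → sumBelow n (λ _ → 0) ≡ 0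
sumBelow-0 zero    = refl
sumBelow-0 (suc n) = trans (+-identityʳ _) (sumBelow-0 n)

sumBelow-+ : ∀ n f g → sumBelow n f + sumBelow n g ≡ sumBelow n (λ k → f k + g k)
sumBelow-+ zero    f g = refl
sumBelow-+ (suc n) f g = trans (+-interchange (sumBelow n f) (f n) (sumBelow n g) (g n))
  (cong (_+ (f n + g n)) (sumBelow-+ n f g))

sum-upTo≡sumBelow : ∀ n f → sum (map f (upTo n)) ≡ sumBelow n f
sum-upTo≡sumBelow zero    f = refl
sum-upTo≡sumBelow (suc n) f = begin
  sum (map f (upTo (suc n)))          ≡⟨ cong (sum ∘ map f) (sym (upTo-∷ʳ n)) ⟩
  sum (map f (upTo n ++ n ∷ []))      ≡⟨ cong sum (map-++ f (upTo n) (n ∷ [])) ⟩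
  sum (map f (upTo n) ++ f n ∷ [])    ≡⟨ sum-++ (map f (upTo n)) (f n ∷ []) ⟩
  sum (map f (upTo n)) + (f n + 0)    ≡⟨ cong₂ _+_ (sum-upTo≡sumBelow n f) (+-identityʳ (f n)) ⟩
  sumBelow n f + f n                  ∎
  where open ≡-Reasoning

sum-map-sumBelow : {A : Set} (xs : List A) (n : ℕ) (F : A → ℕ → ℕ) →
  sum (map (λ x → sumBelow n (F x)) xs) ≡ sumBelow n (λ k → sum (map (λ x → F x k) xs))
sum-map-sumBelow []       n F = sym (sumBelow-0 n)
sum-map-sumBelow (x ∷ xs) n F = trans (cong (_+_ (sumBelow n (F x))) (sum-map-sumBelow xs n F)) (sumBelow-+ n (F x) _)

sumBelow-truncate : ∀ n t f → t ≤ n → (∀ k → t ≤ k → k < n → f k ≡ 0) → sumBelow n f ≡ sumBelow t f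
sumBelow-truncate n       t f t≤n vanish with t ≟ n
sumBelow-truncate n       t f t≤n vanish | yes refl = refl
sumBelow-truncate zero    t f t≤n vanish | no  t≢n  = contradiction (n≤0⇒n≡0 t≤n) t≢n
sumBelow-truncate (suc n) t f t≤n vanish | no  t≢n  = begin
  sumBelow n f + f n
    ≡⟨ cong₂ _+_ (sumBelow-truncate n t f t≤n′ (λ k t≤k k<n → vanish k t≤k (m≤n⇒m≤1+n k<n))) (vanish n t≤n′ ≤-refl) ⟩
  sumBelow t f + 0      ≡⟨ +-identityʳ _ ⟩
  sumBelow t f          ∎
  where
  open ≡-Reasoning
  t≤n′ : t ≤ n
  t≤n′ = ≤-pred (≤∧≢⇒< t≤n t≢n)

scaledInterval⇒∣ : ∀ {q r i} → scaledInterval q r i ≡ true → q ℕ∣.∣ i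
scaledInterval⇒∣ {q} {r} {i} i∈q[r-1] with satisfied (Anyₚ.any⁻ _ (interval r) (Equivalence.from T-≡ i∈q[r-1]))
... | j , qj≡ᵇi = ℕ∣.divides j (trans (sym (≡ᵇ⇒≡ (q * j) i qj≡ᵇi)) (*-comm q j))

∣⇒scaledInterval : ∀ {q r j} → 0 < j → j < r → scaledInterval q r (q * j) ≡ true
∣⇒scaledInterval {q} {suc r} {suc j} _ (s≤s j<r) = Equivalence.to T-≡
  (Anyₚ.any⁺ _ (Anyₚ.map⁺ (Anyₚ.applyUpTo⁺ (λ j → j) (≡⇒≡ᵇ (q * suc j) (q * suc j) refl) j<r)))

-- Descent patterns

data Letter : Set where
  asc des free : Letter

-- w i constrains the comparison of π_i with π_(i+1); positions are 1-based, so w 0 is never read.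
Pattern : Set
Pattern = ℕ → Letter

admits : Letter → Bool → Bool
admits asc  isDescent = not isDescent
admits des  isDescent = isDescent
admits free _         = true

fits : Pattern → List ℕ → Bool
fits w (a ∷ b ∷ π) = admits (w 1) (b <ᵇ a) ∧ fits (w ∘ suc) (b ∷ π)
fits w _           = true

fitCount : ℕ → Pattern → ℕ
fitCount m w = count (fits w) (perms m)

patternOf : Setℕ → Pattern
patternOf S i = if S i then des else asc

patternOf≢free : ∀ S i → patternOf S i ≢ free
patternOf≢free S i with S i
... | true  = λ ()
... | false = λ ()

PermutationShape : ℕ → List ℕ → Set
PermutationShape m π = length π ≡ m × All (_≤ m) π

insertAll-shape : ∀ {m} v π → All (_≤ m) π → v ≤ m →
  All (λ σ → length σ ≡ suc (length π) × All (_≤ m) σ) (insertAll v π)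
insertAll-shape v []       _          v≤m = (refl , v≤m ∷ []) ∷ []
insertAll-shape v (y ∷ ys) (y≤m ∷ ys≤m) v≤m = (refl , v≤m ∷ y≤m ∷ ys≤m)
  ∷ Allₚ.map⁺ (All.map (λ (len , σ≤m) → cong suc len , y≤m ∷ σ≤m) (insertAll-shape v ys ys≤m v≤m))

perms-shape : ∀ m → All (PermutationShape m) (perms m)
perms-shape zero    = (refl , []) ∷ []
perms-shape (suc m) = Allₚ.concat⁺ (Allₚ.map⁺ (All.map insert (perms-shape m)))
  where
  insert : ∀ {π} → PermutationShape m π → All (PermutationShape (suc m)) (insertAll (suc m) π)
  insert (refl , π≤m) = insertAll-shape (suc m) _ (All.map m≤n⇒m≤1+n π≤m) ≤-refl

admits-patternOf : ∀ d s → not (d xor s) ≡ admits (if s then des else asc) d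
admits-patternOf false false = refl
admits-patternOf false true  = refl
admits-patternOf true  false = refl
admits-patternOf true  true  = refl

hasDescSet≡fits : ∀ S π → hasDescSet (length π) S π ≡ fits (patternOf S) π
hasDescSet≡fits S []            = refl
hasDescSet≡fits S (a ∷ [])      = refl
hasDescSet≡fits S (a ∷ b ∷ π)   = cong₂ _∧_ (admits-patternOf (b <ᵇ a) (S 1)) (begin
    all agrees (map suc (applyUpTo suc (length π)))   ≡⟨ all-map agrees suc (applyUpTo suc (length π)) ⟩
    all (agrees ∘ suc) (applyUpTo suc (length π))     ≡⟨ cong (all (agrees ∘ suc)) (sym (map-upTo suc (length π))) ⟩
    all (agrees ∘ suc) (map suc (upTo (length π)))    ≡⟨ all-map (agrees ∘ suc) suc (upTo (length π)) ⟩
    all (agrees ∘ suc ∘ suc) (upTo (length π))        ≡⟨ sym (all-map _ suc (upTo (length π))) ⟩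
    hasDescSet (length (b ∷ π)) (S ∘ suc) (b ∷ π)     ≡⟨ hasDescSet≡fits (S ∘ suc) (b ∷ π) ⟩
    fits (patternOf S ∘ suc) (b ∷ π)                  ∎)
  where
  open ≡-Reasoning
  agrees : ℕ → Bool
  agrees i = not (isDesc (a ∷ b ∷ π) i xor S i)

β≡fitCount : ∀ m S → β m S ≡ fitCount m (patternOf S)
β≡fitCount m S = trans (length-filterᵇ (hasDescSet m S) (perms m))
  (count-cong (All.map (λ { {π} (refl , _) → hasDescSet≡fits S π }) (perms-shape m)))

fits-cong : ∀ {w w′} π → (∀ i → 0 < i → i < length π → w i ≡ w′ i) → fits w π ≡ fits w′ π
fits-cong []          _  = refl
fits-cong (a ∷ [])    _  = refl
fits-cong (a ∷ b ∷ π) eq = cong₂ (λ c rest → admits c (b <ᵇ a) ∧ rest) (eq 1 (s≤s z≤n) (s≤s (s≤s z≤n)))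
  (fits-cong (b ∷ π) (λ i _ i<len → eq (suc i) (s≤s z≤n) (s≤s i<len)))

fitCount-cong : ∀ m {w w′} → (∀ i → 0 < i → i < m → w i ≡ w′ i) → fitCount m w ≡ fitCount m w′
fitCount-cong m eq = count-cong (All.map (λ { {π} (refl , _) → fits-cong π eq }) (perms-shape m))

-- Inserting the largest value

insertAt : ℕ → ℕ → List ℕ → List ℕ
insertAt zero    v π       = v ∷ π
insertAt (suc k) v []      = v ∷ []
insertAt (suc k) v (y ∷ π) = y ∷ insertAt k v π

-- The pattern left for π once the maximum is inserted at index k: position k, whose two
-- values are no longer adjacent, becomes free.
contract : ℕ → Pattern → Pattern
contract zero    w zero    = free
contract zero    w (suc i) = w (suc (suc i))
contract (suc k) w zero    = w zero
contract (suc k) w (suc i) = contract k (w ∘ suc) i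

ascentBefore : Pattern → ℕ → Bool
ascentBefore w zero    = true
ascentBefore w (suc k) = admits (w (suc k)) false

descentAfter : Pattern → ℕ → ℕ → Bool
descentAfter w k L = if k <ᵇ L then admits (w (suc k)) true else true

admitsMaxAt : Pattern → ℕ → ℕ → Bool
admitsMaxAt w k L = ascentBefore w k ∧ descentAfter w k L

fits-insertAt : ∀ w v π k → All (_< v) π → k ≤ length π →
  fits w (insertAt k v π) ≡ admitsMaxAt w k (length π) ∧ fits (contract k w) π
fits-insertAt w v []          zero          _           _ = refl
fits-insertAt w v (y ∷ π)     zero          (y<v ∷ _)   _ =
  cong₂ (λ d rest → admits (w 1) d ∧ rest) (<⇒<ᵇ≡true y<v) (fits-cong (y ∷ π) (λ { (suc i) _ _ → refl }))
fits-insertAt w v (y ∷ [])    (suc zero)    (y<v ∷ _)   _ = trans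
  (cong (λ d → admits (w 1) d ∧ true) (≥⇒<ᵇ≡false (<⇒≤ y<v)))
  (sym (∧-identityʳ _))
fits-insertAt w v (y ∷ [])    (suc (suc k)) _           (s≤s ())
fits-insertAt w v (y ∷ z ∷ π) (suc zero)    (y<v ∷ π<v) _ = trans
  (cong₂ (λ d rest → admits (w 1) d ∧ rest) (≥⇒<ᵇ≡false (<⇒≤ y<v)) (fits-insertAt (w ∘ suc) v (z ∷ π) zero π<v z≤n))
  (sym (∧-assoc (admits (w 1) false) _ _))
fits-insertAt w v (y ∷ z ∷ π) (suc (suc k)) (_ ∷ π<v)   (s≤s k≤len) = trans
  (cong (admits (w 1) (z <ᵇ y) ∧_) (fits-insertAt (w ∘ suc) v (z ∷ π) (suc k) π<v k≤len))
  (∧-x∙yz≈y∙xz (admits (w 1) (z <ᵇ y)) (admitsMaxAt w (suc (suc k)) (length (y ∷ z ∷ π))) _)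

insertAll≡map-insertAt : ∀ v π → insertAll v π ≡ map (λ k → insertAt k v π) (upTo (suc (length π)))
insertAll≡map-insertAt v []      = refl
insertAll≡map-insertAt v (y ∷ π) = cong ((v ∷ y ∷ π) ∷_) (begin
  map (y ∷_) (insertAll v π)                                          ≡⟨ cong (map (y ∷_)) (insertAll≡map-insertAt v π) ⟩
  map (y ∷_) (map (λ k → insertAt k v π) (upTo (suc (length π))))     ≡⟨ sym (map-∘ (upTo (suc (length π)))) ⟩
  map (λ k → insertAt (suc k) v (y ∷ π)) (upTo (suc (length π)))      ≡⟨ map-∘ (upTo (suc (length π))) ⟩
  map (λ k → insertAt k v (y ∷ π)) (map suc (upTo (suc (length π))))  ≡⟨ cong (map _) (map-upTo suc (suc (length π))) ⟩
  map (λ k → insertAt k v (y ∷ π)) (applyUpTo suc (suc (length π)))   ∎)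
  where open ≡-Reasoning

count-insertAll : ∀ w m π → PermutationShape m π →
  count (fits w) (insertAll (suc m) π) ≡ sumBelow (suc m) (λ k → 𝟙 (admitsMaxAt w k m) * 𝟙 (fits (contract k w) π))
count-insertAll w m π (refl , π≤m) = begin
  count (fits w) (insertAll (suc m) π)                                ≡⟨ cong (count (fits w)) (insertAll≡map-insertAt (suc m) π) ⟩
  count (fits w) (map (λ k → insertAt k (suc m) π) (upTo (suc m)))    ≡⟨ cong sum (sym (map-∘ (upTo (suc m)))) ⟩
  sum (map (λ k → 𝟙 (fits w (insertAt k (suc m) π))) (upTo (suc m))) ≡⟨ sum-upTo≡sumBelow (suc m) _ ⟩
  sumBelow (suc m) (λ k → 𝟙 (fits w (insertAt k (suc m) π)))         ≡⟨ sumBelow-cong (suc m) split ⟩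
  sumBelow (suc m) (λ k → 𝟙 (admitsMaxAt w k m) * 𝟙 (fits (contract k w) π)) ∎
  where
  open ≡-Reasoning
  split : ∀ k → k < suc m → 𝟙 (fits w (insertAt k (suc m) π)) ≡ 𝟙 (admitsMaxAt w k m) * 𝟙 (fits (contract k w) π)
  split k k≤m = trans (cong 𝟙 (fits-insertAt w (suc m) π k (All.map s≤s π≤m) (≤-pred k≤m))) (𝟙-∧ (admitsMaxAt w k m) _)

fitCount-suc : ∀ m w → fitCount (suc m) w ≡ sumBelow (suc m) (λ k → 𝟙 (admitsMaxAt w k m) * fitCount m (contract k w))
fitCount-suc m w = begin
  fitCount (suc m) w
    ≡⟨ sum-map-concatMap (𝟙 ∘ fits w) (insertAll (suc m)) (perms m) ⟩
  sum (map (λ π → count (fits w) (insertAll (suc m) π)) (perms m))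
    ≡⟨ sum-map-cong (All.map (count-insertAll w m _) (perms-shape m)) ⟩
  sum (map (λ π → sumBelow (suc m) (λ k → 𝟙 (admitsMaxAt w k m) * 𝟙 (fits (contract k w) π))) (perms m))
    ≡⟨ sum-map-sumBelow (perms m) (suc m) _ ⟩
  sumBelow (suc m) (λ k → sum (map (λ π → 𝟙 (admitsMaxAt w k m) * 𝟙 (fits (contract k w) π)) (perms m)))
    ≡⟨ sumBelow-cong (suc m) (λ k _ → sum-map-*ˡ (perms m) (𝟙 (admitsMaxAt w k m)) _) ⟩
  sumBelow (suc m) (λ k → 𝟙 (admitsMaxAt w k m) * fitCount m (contract k w))
    ∎
  where open ≡-Reasoning

-- Updating one position

infixl 6 _[_≔_]
_[_≔_] : Pattern → ℕ → Letter → Pattern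
(w [ j ≔ c ]) i = if i ≡ᵇ j then c else w i

[≔]-same : ∀ w j c → (w [ j ≔ c ]) j ≡ c
[≔]-same w zero    c = refl
[≔]-same w (suc j) c = [≔]-same (w ∘ suc) j c

[≔]-other : ∀ w {i j} c → i ≢ j → (w [ j ≔ c ]) i ≡ w i
[≔]-other w {zero}  {zero}  c i≢j = contradiction refl i≢j
[≔]-other w {zero}  {suc j} c _   = refl
[≔]-other w {suc i} {zero}  c _   = refl
[≔]-other w {suc i} {suc j} c i≢j = [≔]-other (w ∘ suc) c (i≢j ∘ cong suc)

[≔]-self : ∀ w {j c} → w j ≡ c → ∀ i → (w [ j ≔ c ]) i ≡ w i
[≔]-self w {j} {c} w[j]≡c i with i ≟ j
... | yes refl = trans ([≔]-same w i c) (sym w[j]≡c)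
... | no  i≢j  = [≔]-other w c i≢j

fits-[≔free] : ∀ w j π → 0 < j → j < length π →
  𝟙 (fits (w [ j ≔ free ]) π) ≡ 𝟙 (fits (w [ j ≔ des ]) π) + 𝟙 (fits (w [ j ≔ asc ]) π)
fits-[≔free] w (suc zero) (a ∷ b ∷ π) _ _
  rewrite fits-cong {(w [ 1 ≔ free ]) ∘ suc} {w ∘ suc} (b ∷ π) (λ { (suc i) _ _ → refl })
        | fits-cong {(w [ 1 ≔ des ]) ∘ suc} {w ∘ suc} (b ∷ π) (λ { (suc i) _ _ → refl })
        | fits-cong {(w [ 1 ≔ asc ]) ∘ suc} {w ∘ suc} (b ∷ π) (λ { (suc i) _ _ → refl })
  = 𝟙-split (b <ᵇ a) (fits (w ∘ suc) (b ∷ π))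
  where
  𝟙-split : ∀ d x → 𝟙 x ≡ 𝟙 (d ∧ x) + 𝟙 (not d ∧ x)
  𝟙-split false x = refl
  𝟙-split true  x = sym (+-identityʳ (𝟙 x))
fits-[≔free] w (suc (suc j)) (a ∷ b ∷ π) _ (s≤s j<len) =
  𝟙-∧-+ (admits (w 1) (b <ᵇ a)) (fits-[≔free] (w ∘ suc) (suc j) (b ∷ π) (s≤s z≤n) j<len)
  where
  𝟙-∧-+ : ∀ c {x y z} → 𝟙 x ≡ 𝟙 y + 𝟙 z → 𝟙 (c ∧ x) ≡ 𝟙 (c ∧ y) + 𝟙 (c ∧ z)
  𝟙-∧-+ false _  = refl
  𝟙-∧-+ true  eq = eq
fits-[≔free] w (suc zero)    (a ∷ [])    _ (s≤s ())
fits-[≔free] w (suc (suc j)) (a ∷ [])    _ (s≤s ())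

fitCount-[≔free] : ∀ m w j → 0 < j → j < m →
  fitCount m (w [ j ≔ free ]) ≡ fitCount m (w [ j ≔ des ]) + fitCount m (w [ j ≔ asc ])
fitCount-[≔free] m w j 0<j j<m = trans
  (sum-map-cong (All.map (λ { {π} (refl , _) → fits-[≔free] w j π 0<j j<m }) (perms-shape m)))
  (sum-map-+ (𝟙 ∘ fits (w [ j ≔ des ])) (𝟙 ∘ fits (w [ j ≔ asc ])) (perms m))

-- Descent-free patterns

NoDes : Pattern → Set
NoDes w = ∀ i → w i ≢ des

≢des∧≢free⇒≡asc : ∀ {c} → c ≢ des → c ≢ free → c ≡ asc
≢des∧≢free⇒≡asc {asc}  _      _       = refl
≢des∧≢free⇒≡asc {des}  c≢des  _       = contradiction refl c≢des
≢des∧≢free⇒≡asc {free} _      c≢free  = contradiction refl c≢free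

admits-false : ∀ c → c ≢ des → admits c false ≡ true
admits-false asc  _     = refl
admits-false des  c≢des = contradiction refl c≢des
admits-false free _     = refl

contract-< : ∀ k w {i} → i < k → contract k w i ≡ w i
contract-< (suc k) w {zero}  _         = refl
contract-< (suc k) w {suc i} (s≤s i<k) = contract-< k (w ∘ suc) i<k

contract-≡ : ∀ k w → contract k w k ≡ free
contract-≡ zero    w = refl
contract-≡ (suc k) w = contract-≡ k (w ∘ suc)

contract-> : ∀ k w {i} → k < i → contract k w i ≡ w (suc i)
contract-> zero    w {suc i} _         = refl
contract-> (suc k) w {suc i} (s≤s k<i) = contract-> k (w ∘ suc) k<i

contract-noDes : ∀ k {w} → NoDes w → NoDes (contract k w)
contract-noDes zero    noDes zero    ()
contract-noDes zero    noDes (suc i) = noDes (suc (suc i))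
contract-noDes (suc k) noDes zero    = noDes zero
contract-noDes (suc k) noDes (suc i) = contract-noDes k (noDes ∘ suc) i

ascentBefore-noDes : ∀ {w} k → NoDes w → ascentBefore w k ≡ true
ascentBefore-noDes zero    _     = refl
ascentBefore-noDes (suc k) noDes = admits-false _ (noDes (suc k))

admitsMaxAt-last : ∀ {w} L → NoDes w → admitsMaxAt w L L ≡ true
admitsMaxAt-last L noDes rewrite ascentBefore-noDes L noDes | ≥⇒<ᵇ≡false (≤-refl {L}) = refl

admitsMaxAt-asc : ∀ {w k} L → k < L → w (suc k) ≡ asc → admitsMaxAt w k L ≡ false
admitsMaxAt-asc {w} {k} L k<L w[k+1]≡asc rewrite <⇒<ᵇ≡true k<L | w[k+1]≡asc = ∧-zeroʳ (ascentBefore w k)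

descentAfter-shorten : ∀ w {k t m} → k ≤ t → t < m → (k ≡ t → w (suc k) ≡ free) →
  descentAfter w k m ≡ descentAfter w k t
descentAfter-shorten w {k} {t} k≤t t<m free-at-t with k ≟ t
... | yes refl rewrite <⇒<ᵇ≡true t<m | ≥⇒<ᵇ≡false (≤-refl {k}) | free-at-t refl = refl
... | no  k≢t  rewrite <⇒<ᵇ≡true (≤-trans (s≤s k≤t) t<m) | <⇒<ᵇ≡true (≤∧≢⇒< k≤t k≢t) = refl

-- The values at positions t+1, …, M increase: choose them, then fit the remaining t values.
fitCount-ascentTail : ∀ M t w → NoDes w → t ≤ M → (0 < t → t < M → w t ≡ free) → (∀ i → t < i → i < M → w i ≡ asc) →
  fitCount M w ≡ (M C t) * fitCount t w
fitCount-ascentTail zero    zero w _ _ _ _ = refl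
fitCount-ascentTail (suc m) t w noDes t≤M free-at-t asc-after-t with t ≟ suc m
... | yes refl = sym (trans (cong (_* fitCount (suc m) w) (nCn≡1 (suc m))) (+-identityʳ _))
... | no  t≢M  = begin
  fitCount (suc m) w                     ≡⟨ fitCount-suc m w ⟩
  sumBelow m term + term m               ≡⟨ cong₂ _+_ (sumBelow-truncate m t term t≤m vanish) lastTerm ⟩
  sumBelow t term + (m C t) * fitCount t w ≡⟨ frontTerms t t≤m (λ 0<t → free-at-t 0<t (s≤s t≤m)) asc-after-t ⟩
  (suc m C t) * fitCount t w               ∎
  where
  open ≡-Reasoning
  term : ℕ → ℕ
  term k = 𝟙 (admitsMaxAt w k m) * fitCount m (contract k w)

  t≤m : t ≤ m
  t≤m = ≤-pred (≤∧≢⇒< t≤M t≢M)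

  vanish : ∀ k → t ≤ k → k < m → term k ≡ 0
  vanish k t≤k k<m = cong (λ b → 𝟙 b * fitCount m (contract k w))
    (admitsMaxAt-asc m k<m (asc-after-t (suc k) (s≤s t≤k) (s≤s k<m)))

  lastTerm : term m ≡ (m C t) * fitCount t w
  lastTerm = begin
    𝟙 (admitsMaxAt w m m) * fitCount m (contract m w) ≡⟨ cong (λ b → 𝟙 b * fitCount m (contract m w)) (admitsMaxAt-last m noDes) ⟩
    1 * fitCount m (contract m w)                     ≡⟨ *-identityˡ _ ⟩
    fitCount m (contract m w)                         ≡⟨ fitCount-cong m (λ i _ i<m → contract-< m w i<m) ⟩
    fitCount m w                                      ≡⟨ fitCount-ascentTail m t w noDes t≤m (λ 0<t t<m → free-at-t 0<t (m<n⇒m<1+n t<m))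
                                                           (λ i t<i i<m → asc-after-t i t<i (m<n⇒m<1+n i<m)) ⟩
    (m C t) * fitCount t w                              ∎

  frontTerms : ∀ t → t ≤ m → (0 < t → w t ≡ free) → (∀ i → t < i → i < suc m → w i ≡ asc) →
    sumBelow t term + (m C t) * fitCount t w ≡ (suc m C t) * fitCount t w
  frontTerms zero     _     _         _           = refl
  frontTerms (suc t′) t<m free-at-t asc-after-t = begin
    sumBelow (suc t′) term + (m C suc t′) * fitCount (suc t′) w         ≡⟨ cong (_+ (m C suc t′) * fitCount (suc t′) w) front ⟩
    (m C t′) * fitCount (suc t′) w + (m C suc t′) * fitCount (suc t′) w ≡⟨ sym (*-distribʳ-+ (fitCount (suc t′) w) (m C t′) _) ⟩
    (m C t′ + m C suc t′) * fitCount (suc t′) w                         ≡⟨ cong (_* fitCount (suc t′) w) (nCk+nC[k+1]≡[n+1]C[k+1] m t′) ⟩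
    (suc m C suc t′) * fitCount (suc t′) w                              ∎
    where
    termₖ : ∀ k → k < suc t′ → term k ≡ (m C t′) * (𝟙 (admitsMaxAt w k t′) * fitCount t′ (contract k w))
    termₖ k (s≤s k≤t′) = trans
      (cong₂ (λ b n → 𝟙 b * n)
        (cong (ascentBefore w k ∧_) (descentAfter-shorten w k≤t′ t<m (λ { refl → free-at-t (s≤s z≤n) })))
        (fitCount-ascentTail m t′ (contract k w) (contract-noDes k noDes) (<⇒≤ t<m) free′ asc′))
      (*-x∙yz≈y∙xz (𝟙 (admitsMaxAt w k t′)) (m C t′) _)
      where
      free′ : 0 < t′ → t′ < m → contract k w t′ ≡ free
      free′ _ _ with k ≟ t′
      ... | yes refl = contract-≡ k w
      ... | no  k≢t′ = trans (contract-> k w (≤∧≢⇒< k≤t′ k≢t′)) (free-at-t (s≤s z≤n))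
      asc′ : ∀ i → t′ < i → i < m → contract k w i ≡ asc
      asc′ i t′<i i<m = trans (contract-> k w (≤-<-trans k≤t′ t′<i)) (asc-after-t (suc i) (s≤s t′<i) (s≤s i<m))

    front : sumBelow (suc t′) term ≡ (m C t′) * fitCount (suc t′) w
    front = begin
      sumBelow (suc t′) term
        ≡⟨ sumBelow-cong (suc t′) termₖ ⟩
      sumBelow (suc t′) (λ k → (m C t′) * (𝟙 (admitsMaxAt w k t′) * fitCount t′ (contract k w)))
        ≡⟨ sumBelow-*ˡ (suc t′) (m C t′) _ ⟩
      (m C t′) * sumBelow (suc t′) (λ k → 𝟙 (admitsMaxAt w k t′) * fitCount t′ (contract k w))
        ≡⟨ cong ((m C t′) *_) (sym (fitCount-suc t′ w)) ⟩
      (m C t′) * fitCount (suc t′) w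
        ∎

isFree : Letter → Bool
isFree free = true
isFree _    = false

lastFree : Pattern → ℕ → ℕ
lastFree w zero    = 0
lastFree w (suc k) = if isFree (w k) then k else lastFree w k

lastFree-≤ : ∀ w k → lastFree w (suc k) ≤ k
lastFree-≤ w zero    with isFree (w 0)
... | true  = ≤-refl
... | false = ≤-refl
lastFree-≤ w (suc k) with isFree (w (suc k))
... | true  = ≤-refl
... | false = m≤n⇒m≤1+n (lastFree-≤ w k)

lastFree-< : ∀ w {n} → 0 < n → lastFree w n < n
lastFree-< w {suc k} _ = s≤s (lastFree-≤ w k)

lastFree-free : ∀ w n → 0 < lastFree w n → w (lastFree w n) ≡ free
lastFree-free w (suc k) 0<ℓ with w k in w[k]
... | free = w[k]
... | asc  = lastFree-free w k 0<ℓ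
... | des  = lastFree-free w k 0<ℓ

lastFree-max : ∀ w n {i} → lastFree w n < i → i < n → w i ≢ free
lastFree-max w (suc k) {i} ℓ<i (s≤s i≤k) w[i]≡free with isFree (w k) in isFree[k]
... | true  = <⇒≱ ℓ<i i≤k
... | false with i ≟ k
...   | yes refl = contradiction (trans (sym (cong isFree w[i]≡free)) isFree[k]) λ ()
...   | no  i≢k  = lastFree-max w k ℓ<i (≤∧≢⇒< i≤k i≢k) w[i]≡free

fitCount-lastFree : ∀ n w → NoDes w → 0 < n → fitCount n w ≡ (n C lastFree w n) * fitCount (lastFree w n) w
fitCount-lastFree n w noDes 0<n = fitCount-ascentTail n (lastFree w n) w noDes (<⇒≤ (lastFree-< w 0<n))
  (λ 0<ℓ _ → lastFree-free w n 0<ℓ)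
  (λ i ℓ<i i<n → ≢des∧≢free⇒≡asc (noDes i) (lastFree-max w n ℓ<i i<n))

divPattern : Pattern → ℕ → Pattern
divPattern w q j = w (q * j)

-- Reduction modulo p

module CountsModPrimePower (p-1 : ℕ) (p-prime : Prime (suc p-1)) (t : ℕ) where

  open BinomialsModPrime p-1 p-prime
  open Congruence (+ p)
  open SetoidReasoning ≈-setoid

  q : ℕ
  q = p ^ t

  instance
    q-nonZero : NonZero q
    q-nonZero = m^n≢0 p t

  0<q : 0 < q
  0<q = m^n>0 p t

  FreeOnlyAtMultiples : ℕ → Pattern → Set
  FreeOnlyAtMultiples n w = ∀ i → 0 < i → i < n → w i ≡ free → q ℕ∣.∣ i

  FreeOffMultiple : ℕ → Pattern → Set
  FreeOffMultiple n w = ∃[ i ] 0 < i × i < n × ¬ q ℕ∣.∣ i × w i ≡ free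

  0<[1+r]q : ∀ r → 0 < suc r * q
  0<[1+r]q r = ≤-trans 0<q (m≤m+n q (r * q))

  0<q* : ∀ {s} → 0 < s → 0 < q * s
  0<q* {s} 0<s = ≤-trans 0<q (m≤m*n q s {{>-nonZero 0<s}})

  lastFree≡sq⇒s<1+r : ∀ w r {s} → lastFree w (suc r * q) ≡ s * q → s < suc r
  lastFree≡sq⇒s<1+r w r {s} ℓ≡sq = *-cancelʳ-< q s (suc r) (subst (_< suc r * q) ℓ≡sq (lastFree-< w (0<[1+r]q r)))

  fitCount≈fitCount-divPattern : ∀ r w → Acc _<_ r → NoDes w → FreeOnlyAtMultiples (r * q) w →
    + fitCount (r * q) w ≈ + fitCount r (divPattern w q)
  fitCount≈fitCount-divPattern zero      w _         _     _        = ≈-refl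
  fitCount≈fitCount-divPattern (suc r′) w (acc rec) noDes onlyMult with q ℕ∣.∣? lastFree w (suc r′ * q)
  ... | no  q∤ℓ = contradiction (onlyMult _ 0<ℓ (lastFree-< w (0<[1+r]q r′)) (lastFree-free w (suc r′ * q) 0<ℓ)) q∤ℓ
    where
    0<ℓ : 0 < lastFree w (suc r′ * q)
    0<ℓ = n≢0⇒n>0 (λ ℓ≡0 → q∤ℓ (subst (q ℕ∣.∣_) (sym ℓ≡0) (ℕ∣.divides 0 refl)))
  ... | yes (ℕ∣.divides s ℓ≡sq) = begin
    + fitCount n w                            ≡⟨ cong +_ (fitCount-lastFree n w noDes (0<[1+r]q r′)) ⟩
    + ((n C ℓ) * fitCount ℓ w)                ≡⟨ cong (λ k → + ((n C k) * fitCount k w)) ℓ≡sq ⟩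
    + ((n C (s * q)) * fitCount (s * q) w)    ≈⟨ pos-*-cong ([rq]C[sq]≈rCs t r s) IH ⟩
    + ((r C s) * fitCount s (divPattern w q)) ≡⟨ cong +_ (sym ascentTail) ⟩
    + fitCount r (divPattern w q)             ∎
    where
    r = suc r′
    n = r * q
    ℓ = lastFree w n
    s<r : s < r
    s<r = lastFree≡sq⇒s<1+r w r′ ℓ≡sq
    sq≤n : s * q ≤ n
    sq≤n = *-monoˡ-≤ q (<⇒≤ s<r)
    IH : + fitCount (s * q) w ≈ + fitCount s (divPattern w q)
    IH = fitCount≈fitCount-divPattern s w (rec s<r) noDes (λ i 0<i i<sq → onlyMult i 0<i (<-≤-trans i<sq sq≤n))
    qs≡ℓ : q * s ≡ ℓ
    qs≡ℓ = trans (*-comm q s) (sym ℓ≡sq)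
    free-at-s : 0 < s → s < r → w (q * s) ≡ free
    free-at-s 0<s _ = subst (λ k → w k ≡ free) (sym qs≡ℓ) (lastFree-free w n (subst (0 <_) qs≡ℓ (0<q* 0<s)))
    asc-after-s : ∀ i → s < i → i < r → w (q * i) ≡ asc
    asc-after-s i s<i i<r = ≢des∧≢free⇒≡asc (noDes (q * i))
      (lastFree-max w n (subst (_< q * i) qs≡ℓ (*-monoʳ-< q s<i)) (subst (_< n) (*-comm i q) (*-monoˡ-< q i<r)))
    ascentTail : fitCount r (divPattern w q) ≡ (r C s) * fitCount s (divPattern w q)
    ascentTail = fitCount-ascentTail r s (divPattern w q) (noDes ∘ (q *_)) (<⇒≤ s<r) free-at-s asc-after-s

  fitCount≈0 : ∀ r w → Acc _<_ r → NoDes w → FreeOffMultiple (r * q) w → + fitCount (r * q) w ≈ 0ℤ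
  fitCount≈0 (suc r′) w (acc rec) noDes (i , 0<i , i<n , q∤i , w[i]≡free) with q ℕ∣.∣? lastFree w (suc r′ * q)
  ... | no  q∤ℓ = begin
    + fitCount n w                          ≡⟨ cong +_ (fitCount-lastFree n w noDes (0<[1+r]q r′)) ⟩
    + ((n C ℓ) * fitCount ℓ w)              ≈⟨ pos-*-cong ([rq]Ci≈0 t r q∤ℓ) (≈-refl {+ fitCount ℓ w}) ⟩
    0ℤ                                      ∎
    where
    r = suc r′
    n = r * q
    ℓ = lastFree w n
  ... | yes (ℕ∣.divides s ℓ≡sq) = begin
    + fitCount n w                          ≡⟨ cong +_ (fitCount-lastFree n w noDes (0<[1+r]q r′)) ⟩
    + ((n C ℓ) * fitCount ℓ w)              ≡⟨ cong (λ k → + ((n C k) * fitCount k w)) ℓ≡sq ⟩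
    + ((n C (s * q)) * fitCount (s * q) w)  ≈⟨ pos-*-cong (≈-refl {+ (n C (s * q))}) IH ⟩
    + ((n C (s * q)) * 0)                   ≡⟨ cong +_ (*-zeroʳ (n C (s * q))) ⟩
    0ℤ                                      ∎
    where
    r = suc r′
    n = r * q
    ℓ = lastFree w n
    s<r : s < r
    s<r = lastFree≡sq⇒s<1+r w r′ ℓ≡sq
    i<ℓ : i < ℓ
    i<ℓ with i ≤? ℓ
    ... | no  i≰ℓ = contradiction w[i]≡free (lastFree-max w n (≰⇒> i≰ℓ) i<n)
    ... | yes i≤ℓ = ≤∧≢⇒< i≤ℓ (λ i≡ℓ → q∤i (ℕ∣.divides s (trans i≡ℓ ℓ≡sq)))
    IH : + fitCount (s * q) w ≈ 0ℤ
    IH = fitCount≈0 s w (rec s<r) noDes (i , 0<i , subst (i <_) ℓ≡sq i<ℓ , q∤i , w[i]≡free)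

isDes : Letter → Bool
isDes des = true
isDes _   = false

isDes-false : ∀ {c} → c ≢ des → isDes c ≡ false
isDes-false {asc}  _     = refl
isDes-false {des}  c≢des = contradiction refl c≢des
isDes-false {free} _     = refl

noDesFrom-pred : ∀ (w : Pattern) {j c} → w j ≡ c → c ≢ des →
  (∀ i → suc j ≤ i → w i ≢ des) → ∀ i → j ≤ i → w i ≢ des
noDesFrom-pred w {j} w[j]≡c c≢des noDesFrom i j≤i with i ≟ j
... | yes refl = subst (_≢ des) (sym w[j]≡c) c≢des
... | no  i≢j  = noDesFrom i (≤∧≢⇒< j≤i (i≢j ∘ sym))

module InclusionExclusion (p-1 : ℕ) (p-prime : Prime (suc p-1)) (t r : ℕ) where

  open BinomialsModPrime p-1 p-prime using (p)
  open CountsModPrimePower p-1 p-prime t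
  open Congruence (+ p)

  n : ℕ
  n = r * q

  descentsOff : Pattern → ℕ
  descentsOff w = count (λ i → isDes (w i) ∧ not (scaledInterval q r i)) (interval n)

  AscOutside : Pattern → Set
  AscOutside w = ∀ i → i ≡ 0 ⊎ n ≤ i → w i ≡ asc

  FitCountCongruences : Pattern → Set
  FitCountCongruences w =
      (FreeOnlyAtMultiples n w → + fitCount n w ≈ (-1ℤ ^ℤ descentsOff w) *ℤ + fitCount r (divPattern w q))
    × (FreeOffMultiple n w → + fitCount n w ≈ 0ℤ)

  noDes⇒fitCountCongruences : ∀ {w} → NoDes w → FitCountCongruences w
  noDes⇒fitCountCongruences {w} noDes = onlyAtMultiples , fitCount≈0 r w (<-wellFounded r) noDes
    where
    open SetoidReasoning ≈-setoid
    descentsOff≡0 : descentsOff w ≡ 0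
    descentsOff≡0 = trans (count-cong (All.universal (λ i → cong (_∧ _) (isDes-false (noDes i))) (interval n)))
                     (count-false (interval n))
    onlyAtMultiples : FreeOnlyAtMultiples n w → + fitCount n w ≈ (-1ℤ ^ℤ descentsOff w) *ℤ + fitCount r (divPattern w q)
    onlyAtMultiples onlyMult = begin
      + fitCount n w                                    ≈⟨ fitCount≈fitCount-divPattern r w (<-wellFounded r) noDes onlyMult ⟩
      + fitCount r (divPattern w q)                     ≡⟨ sym (ℤₚ.*-identityˡ _) ⟩
      (-1ℤ ^ℤ 0) *ℤ + fitCount r (divPattern w q)       ≡⟨ cong (λ d → (-1ℤ ^ℤ d) *ℤ + fitCount r (divPattern w q)) (sym descentsOff≡0) ⟩
      (-1ℤ ^ℤ descentsOff w) *ℤ + fitCount r (divPattern w q) ∎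

  module _ {w : Pattern} {j : ℕ} (ascOutside : AscOutside w) (w[j]≡des : w j ≡ des) where

    private
      asc≢des : asc ≢ des
      asc≢des ()

      free≢des : free ≢ des
      free≢des ()

      0<j : 0 < j
      0<j = n≢0⇒n>0 (λ j≡0 → asc≢des (trans (sym (ascOutside j (inj₁ j≡0))) w[j]≡des))

      j<n : j < n
      j<n = ≰⇒> (λ n≤j → asc≢des (trans (sym (ascOutside j (inj₂ n≤j))) w[j]≡des))

    ascOutside-[≔] : ∀ c → AscOutside (w [ j ≔ c ])
    ascOutside-[≔] c i outside = trans ([≔]-other w c i≢j) (ascOutside i outside)
      where
      i≢j : i ≢ j
      i≢j refl = [ (λ j≡0 → <-irrefl (sym j≡0) 0<j) , (λ n≤j → <⇒≱ j<n n≤j) ] outside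

    fitCount-split : + fitCount n w +ℤ + fitCount n (w [ j ≔ asc ]) ≡ + fitCount n (w [ j ≔ free ])
    fitCount-split = begin
      + fitCount n w +ℤ + fitCount n (w [ j ≔ asc ])
        ≡⟨ sym (ℤₚ.pos-+ (fitCount n w) _) ⟩
      + (fitCount n w + fitCount n (w [ j ≔ asc ]))
        ≡⟨ cong (λ k → + (k + fitCount n (w [ j ≔ asc ]))) (fitCount-cong n (λ i _ _ → sym ([≔]-self w w[j]≡des i))) ⟩
      + (fitCount n (w [ j ≔ des ]) + fitCount n (w [ j ≔ asc ]))
        ≡⟨ cong +_ (sym (fitCount-[≔free] n w j 0<j j<n)) ⟩
      + fitCount n (w [ j ≔ free ])
        ∎
      where open ≡-Reasoning

    freeOffMultiple-[≔] : ∀ c → FreeOffMultiple n w → FreeOffMultiple n (w [ j ≔ c ])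
    freeOffMultiple-[≔] c (i , 0<i , i<n , q∤i , w[i]≡free) = i , 0<i , i<n , q∤i , trans ([≔]-other w c i≢j) w[i]≡free
      where
      i≢j : i ≢ j
      i≢j refl = free≢des (trans (sym w[i]≡free) w[j]≡des)

    freeOnlyAtMultiples-[≔] : ∀ c → (c ≡ free → q ℕ∣.∣ j) → FreeOnlyAtMultiples n w → FreeOnlyAtMultiples n (w [ j ≔ c ])
    freeOnlyAtMultiples-[≔] c c-free onlyMult i 0<i i<n w′[i]≡free with i ≟ j
    ... | yes refl = c-free (trans (sym ([≔]-same w i c)) w′[i]≡free)
    ... | no  i≢j  = onlyMult i 0<i i<n (trans (sym ([≔]-other w c i≢j)) w′[i]≡free)

    descentsOff-[≔]-scaled : ∀ c → scaledInterval q r j ≡ true → descentsOff (w [ j ≔ c ]) ≡ descentsOff w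
    descentsOff-[≔]-scaled c j∈q[r-1] = count-cong (All.universal agree (interval n))
      where
      agree : ∀ i → isDes ((w [ j ≔ c ]) i) ∧ not (scaledInterval q r i) ≡ isDes (w i) ∧ not (scaledInterval q r i)
      agree i with i ≟ j
      ... | yes refl rewrite j∈q[r-1] = trans (∧-zeroʳ _) (sym (∧-zeroʳ _))
      ... | no  i≢j  = cong (λ c → isDes c ∧ not (scaledInterval q r i)) ([≔]-other w c i≢j)

    descentsOff-[≔asc] : scaledInterval q r j ≡ false → descentsOff w ≡ suc (descentsOff (w [ j ≔ asc ]))
    descentsOff-[≔asc] j∉q[r-1] = begin
      descentsOff w                                              ≡⟨ count-update j (interval n) agree counted uncounted ⟩
      descentsOff (w [ j ≔ asc ]) + count (_≡ᵇ j) (interval n)   ≡⟨ cong (_+_ (descentsOff (w [ j ≔ asc ]))) (count-≡ᵇ-interval 0<j j<n) ⟩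
      descentsOff (w [ j ≔ asc ]) + 1                            ≡⟨ +-comm _ 1 ⟩
      suc (descentsOff (w [ j ≔ asc ]))                          ∎
      where
      open ≡-Reasoning
      agree : ∀ i → i ≢ j → isDes (w i) ∧ not (scaledInterval q r i) ≡ isDes ((w [ j ≔ asc ]) i) ∧ not (scaledInterval q r i)
      agree i i≢j = cong (λ c → isDes c ∧ not (scaledInterval q r i)) (sym ([≔]-other w asc i≢j))
      counted : isDes (w j) ∧ not (scaledInterval q r j) ≡ true
      counted rewrite w[j]≡des | j∉q[r-1] = refl
      uncounted : isDes ((w [ j ≔ asc ]) j) ∧ not (scaledInterval q r j) ≡ false
      uncounted rewrite [≔]-same w j asc = refl

    fitCount-divPattern-[≔] : ∀ {j₀} c → q * j₀ ≡ j →
      fitCount r (divPattern (w [ j ≔ c ]) q) ≡ fitCount r (divPattern w q [ j₀ ≔ c ])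
    fitCount-divPattern-[≔] {j₀} c qj₀≡j = fitCount-cong r (λ i _ _ → agree i)
      where
      agree : ∀ i → (w [ j ≔ c ]) (q * i) ≡ (divPattern w q [ j₀ ≔ c ]) i
      agree i with i ≟ j₀
      ... | yes refl = trans (cong (w [ j ≔ c ]) qj₀≡j) (trans ([≔]-same w j c) (sym ([≔]-same (divPattern w q) i c)))
      ... | no  i≢j₀ = trans ([≔]-other w c (λ qi≡j → i≢j₀ (*-cancelˡ-≡ i j₀ q (trans qi≡j (sym qj₀≡j)))))
                             (sym ([≔]-other (divPattern w q) c i≢j₀))

    fitCount-divPattern-split : ∀ {j₀} → q * j₀ ≡ j → 0 < j₀ → j₀ < r →
      + fitCount r (divPattern (w [ j ≔ free ]) q) ≡ + fitCount r (divPattern w q) +ℤ + fitCount r (divPattern (w [ j ≔ asc ]) q)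
    fitCount-divPattern-split {j₀} qj₀≡j 0<j₀ j₀<r = begin
      + fitCount r (divPattern (w [ j ≔ free ]) q)   ≡⟨ cong +_ (fitCount-divPattern-[≔] free qj₀≡j) ⟩
      + fitCount r (divPattern w q [ j₀ ≔ free ])     ≡⟨ cong +_ (fitCount-[≔free] r (divPattern w q) j₀ 0<j₀ j₀<r) ⟩
      + (fitCount r (divPattern w q [ j₀ ≔ des ]) + fitCount r (divPattern w q [ j₀ ≔ asc ]))
        ≡⟨ cong₂ (λ a b → + (a + b)) (fitCount-cong r (λ i _ _ → [≔]-self (divPattern w q) (trans (cong w qj₀≡j) w[j]≡des) i))
                                     (sym (fitCount-divPattern-[≔] asc qj₀≡j)) ⟩
      + (fitCount r (divPattern w q) + fitCount r (divPattern (w [ j ≔ asc ]) q)) ≡⟨ ℤₚ.pos-+ (fitCount r (divPattern w q)) _ ⟩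
      + fitCount r (divPattern w q) +ℤ + fitCount r (divPattern (w [ j ≔ asc ]) q) ∎
      where open ≡-Reasoning

    congruence-multiple : ∀ {j₀} → j ≡ j₀ * q → FitCountCongruences (w [ j ≔ free ]) → FitCountCongruences (w [ j ≔ asc ]) →
      FreeOnlyAtMultiples n w → + fitCount n w ≈ (-1ℤ ^ℤ descentsOff w) *ℤ + fitCount r (divPattern w q)
    congruence-multiple {j₀} j≡j₀q (free-only , _) (asc-only , _) onlyMult = +-cancelʳ (begin
      + fitCount n w +ℤ + fitCount n (w [ j ≔ asc ])  ≡⟨ fitCount-split ⟩
      + fitCount n (w [ j ≔ free ])                    ≈⟨ free-only (freeOnlyAtMultiples-[≔] free (λ _ → q∣j) onlyMult) ⟩
      σ (w [ j ≔ free ]) *ℤ F (w [ j ≔ free ])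
        ≡⟨ cong₂ _*ℤ_ (cong (-1ℤ ^ℤ_) (descentsOff-[≔]-scaled free j∈q[r-1])) (fitCount-divPattern-split qj₀≡j 0<j₀ j₀<r) ⟩
      σ w *ℤ (F w +ℤ F (w [ j ≔ asc ]))                ≡⟨ ℤₚ.*-distribˡ-+ (σ w) (F w) _ ⟩
      σ w *ℤ F w +ℤ σ w *ℤ F (w [ j ≔ asc ])           ∎)
      (subst (λ d → + fitCount n (w [ j ≔ asc ]) ≈ (-1ℤ ^ℤ d) *ℤ F (w [ j ≔ asc ])) (descentsOff-[≔]-scaled asc j∈q[r-1])
        (asc-only (freeOnlyAtMultiples-[≔] asc (λ ()) onlyMult)))
      where
      open SetoidReasoning ≈-setoid
      σ : Pattern → ℤ
      σ v = -1ℤ ^ℤ descentsOff v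
      F : Pattern → ℤ
      F v = + fitCount r (divPattern v q)
      qj₀≡j : q * j₀ ≡ j
      qj₀≡j = trans (*-comm q j₀) (sym j≡j₀q)
      q∣j : q ℕ∣.∣ j
      q∣j = ℕ∣.divides j₀ j≡j₀q
      0<j₀ : 0 < j₀
      0<j₀ = n≢0⇒n>0 (λ j₀≡0 → <-irrefl (sym (trans j≡j₀q (cong (_* q) j₀≡0))) 0<j)
      j₀<r : j₀ < r
      j₀<r = *-cancelʳ-< q j₀ r (subst (_< n) j≡j₀q j<n)
      j∈q[r-1] : scaledInterval q r j ≡ true
      j∈q[r-1] = subst (λ k → scaledInterval q r k ≡ true) qj₀≡j (∣⇒scaledInterval {q} 0<j₀ j₀<r)

    congruence-nonmultiple : ¬ q ℕ∣.∣ j → FitCountCongruences (w [ j ≔ free ]) → FitCountCongruences (w [ j ≔ asc ]) →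
      FreeOnlyAtMultiples n w → + fitCount n w ≈ (-1ℤ ^ℤ descentsOff w) *ℤ + fitCount r (divPattern w q)
    congruence-nonmultiple q∤j (_ , free-off) (asc-only , _) onlyMult = begin
      + fitCount n w                  ≈⟨ +-cancelʳ sum≈0 (subst (λ k → + fitCount n (w [ j ≔ asc ]) ≈ σ′ *ℤ + k) F-asc≡F
                                            (asc-only (freeOnlyAtMultiples-[≔] asc (λ ()) onlyMult))) ⟩
      - (σ′ *ℤ F)                     ≡⟨ sym (ℤₚ.-1*i≡-i (σ′ *ℤ F)) ⟩
      -1ℤ *ℤ (σ′ *ℤ F)                ≡⟨ sym (ℤₚ.*-assoc -1ℤ σ′ F) ⟩
      (-1ℤ ^ℤ suc (descentsOff (w [ j ≔ asc ]))) *ℤ F ≡⟨ cong (λ d → (-1ℤ ^ℤ d) *ℤ F) (sym (descentsOff-[≔asc] j∉q[r-1])) ⟩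
      (-1ℤ ^ℤ descentsOff w) *ℤ F          ∎
      where
      open SetoidReasoning ≈-setoid
      σ′ : ℤ
      σ′ = -1ℤ ^ℤ descentsOff (w [ j ≔ asc ])
      F : ℤ
      F = + fitCount r (divPattern w q)
      j∉q[r-1] : scaledInterval q r j ≡ false
      j∉q[r-1] = ¬-not (q∤j ∘ scaledInterval⇒∣ {q} {r})
      F-asc≡F : fitCount r (divPattern (w [ j ≔ asc ]) q) ≡ fitCount r (divPattern w q)
      F-asc≡F = fitCount-cong r (λ i _ _ → [≔]-other w asc (λ qi≡j → q∤j (ℕ∣.divides i (trans (sym qi≡j) (*-comm q i)))))
      sum≈0 : + fitCount n w +ℤ + fitCount n (w [ j ≔ asc ]) ≈ - (σ′ *ℤ F) +ℤ σ′ *ℤ F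
      sum≈0 = begin
        + fitCount n w +ℤ + fitCount n (w [ j ≔ asc ]) ≡⟨ fitCount-split ⟩
        + fitCount n (w [ j ≔ free ])                   ≈⟨ free-off (j , 0<j , j<n , q∤j , [≔]-same w j free) ⟩
        0ℤ                                              ≡⟨ sym (ℤₚ.+-inverseˡ (σ′ *ℤ F)) ⟩
        - (σ′ *ℤ F) +ℤ σ′ *ℤ F                          ∎

    des⇒fitCountCongruences : FitCountCongruences (w [ j ≔ free ]) → FitCountCongruences (w [ j ≔ asc ]) → FitCountCongruences w
    des⇒fitCountCongruences free-cong asc-cong = onlyAtMultiples , offMultiple
      where
      onlyAtMultiples : FreeOnlyAtMultiples n w → + fitCount n w ≈ (-1ℤ ^ℤ descentsOff w) *ℤ + fitCount r (divPattern w q)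
      onlyAtMultiples with q ℕ∣.∣? j
      ... | yes (ℕ∣.divides j₀ j≡j₀q) = congruence-multiple {j₀} j≡j₀q free-cong asc-cong
      ... | no  q∤j                   = congruence-nonmultiple q∤j free-cong asc-cong
      offMultiple : FreeOffMultiple n w → + fitCount n w ≈ 0ℤ
      offMultiple off = +-cancelʳ
        (≈-trans (≈-reflexive fitCount-split) (proj₂ free-cong (freeOffMultiple-[≔] free off)))
        (proj₂ asc-cong (freeOffMultiple-[≔] asc off))

  fitCountCongruences : ∀ j w → AscOutside w → (∀ i → j ≤ i → w i ≢ des) → FitCountCongruences w
  fitCountCongruences zero    w _          noDesFrom = noDes⇒fitCountCongruences (λ i → noDesFrom i z≤n)
  fitCountCongruences (suc j) w ascOutside noDesFrom with w j in w[j]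
  ... | asc  = fitCountCongruences j w ascOutside (noDesFrom-pred w w[j] (λ ()) noDesFrom)
  ... | free = fitCountCongruences j w ascOutside (noDesFrom-pred w w[j] (λ ()) noDesFrom)
  ... | des  = des⇒fitCountCongruences ascOutside w[j] (update free (λ ())) (update asc (λ ()))
    where
    update : ∀ c → c ≢ des → FitCountCongruences (w [ j ≔ c ])
    update c c≢des = fitCountCongruences j (w [ j ≔ c ]) (ascOutside-[≔] ascOutside w[j] c)
      (noDesFrom-pred (w [ j ≔ c ]) ([≔]-same w j c) c≢des (λ i j<i → subst (_≢ des) (sym ([≔]-other w c (>⇒≢ j<i))) (noDesFrom i j<i)))

  β-congruence : ∀ S → (∀ i → S i ≡ true → 1 ≤ i × i < n) →
    + β n S ≈ (-1ℤ ^ℤ cardDiff n S q r) *ℤ + β r (divSet S q)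
  β-congruence S S⊆[n-1] = begin
    + β n S
      ≡⟨ cong +_ (β≡fitCount n S) ⟩
    + fitCount n w
      ≈⟨ proj₁ (fitCountCongruences n w ascOutside noDesFrom-n) freeNowhere ⟩
    (-1ℤ ^ℤ descentsOff w) *ℤ + fitCount r (divPattern w q)
      ≡⟨ cong₂ (λ d b → (-1ℤ ^ℤ d) *ℤ + b) (sym cardDiff≡descentsOff) (sym (β≡fitCount r (divSet S q))) ⟩
    (-1ℤ ^ℤ cardDiff n S q r) *ℤ + β r (divSet S q)
      ∎
    where
    open SetoidReasoning ≈-setoid
    w : Pattern
    w = patternOf S
    S-false : ∀ {i} → ¬ (1 ≤ i × i < n) → S i ≡ false
    S-false {i} i∉[n-1] with S i in S[i]
    ... | true  = contradiction (S⊆[n-1] i S[i]) i∉[n-1]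
    ... | false = refl
    ascOutside : AscOutside w
    ascOutside i outside rewrite S-false {i} (λ (1≤i , i<n) → [ (λ { refl → <-irrefl refl 1≤i }) , <⇒≱ i<n ] outside) = refl
    freeNowhere : FreeOnlyAtMultiples n w
    freeNowhere i _ _ w[i]≡free = contradiction w[i]≡free (patternOf≢free S i)
    noDesFrom-n : ∀ i → n ≤ i → w i ≢ des
    noDesFrom-n i n≤i rewrite S-false {i} (λ (_ , i<n) → <⇒≱ i<n n≤i) = λ ()
    cardDiff≡descentsOff : cardDiff n S q r ≡ descentsOff w
    cardDiff≡descentsOff = trans (length-filterᵇ _ (interval n)) (count-cong (All.universal agree (interval n)))
      where
      agree : ∀ i → S i ∧ not (scaledInterval q r i) ≡ isDes (w i) ∧ not (scaledInterval q r i)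
      agree i with S i
      ... | true  = refl
      ... | false = refl

proposition5p1 : (p t r : ℕ) → Prime p → 1 ≤ r →
    (S : Setℕ) → (∀ i → S i ≡ true → 1 ≤ i × i < r * p ^ t) →
    (+ p) ∣ ((+ β (r * p ^ t) S) - ((-[1+ 0 ] ^ℤ cardDiff (r * p ^ t) S (p ^ t) r) *ℤ (+ β r (divSet S (p ^ t)))))
proposition5p1 zero        t r p-prime _ S S⊆[n-1] = contradiction p-prime ¬prime[0]
proposition5p1 (suc p-1) t r p-prime _ S S⊆[n-1] =
  ℤ∣.∣⇒∣ᵤ (Congruence._≈_.divides (InclusionExclusion.β-congruence p-1 p-prime t r S S⊆[n-1]))
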